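{- Let $T\subseteq\mathbb{Z}^n$ be an integer tiling with $\Upsilon_n$ such that $\mathbf{0}\in T$, and let $\mathcal{D}_2$ be the set of points of $\{0,1,4\}^n$ in which the symbol $4$ appears exactly once. If $X\in\mathcal{D}_2\cap T$, then $X=4e_r$ for some $1\le r\le n$.
   Context: $e_r$ is the $r$-th unit vector. $\Upsilon_n=\{U\in\mathbb{Z}^n:\sum_i|x_i-u_i|\le1\text{ for some }X\in\{ -1,0\}^n\}$. A set $T\subseteq\mathbb{Z}^n$ is an integer tiling with $\Upsilon_n$ if the translates $X+\Upsilon_n$, $X\in T$, partition $\mathbb{Z}^n$. -}

module Defs where

open import Data.Nat as ℕ using (ℕ)
open import Data.Integer using (ℤ; +_; -[1+_]; _-_; _+_; _*_; ∣_∣)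
open import Data.Fin using (Fin)
open import Data.Vec.Functional using (Vector; foldr)
open import Data.Product using (Σ; ∃; _×_)
open import Data.Sum using (_⊎_)
open import Relation.Binary.PropositionalEquality using (_≡_)
import Data.Fin
import Relation.Nullary

Point : ℕ → Set
Point n = Fin n → ℤ

sumℕ : ∀ {n} → (Fin n → ℕ) → ℕ
sumℕ v = foldr ℕ._+_ 0 v

dist₁ : ∀ {n} → Point n → Point n → ℕ
dist₁ X U = sumℕ (λ i → ∣ X i - U i ∣)

InMinusOneZero : ∀ {n} → Point n → Set
InMinusOneZero X = ∀ i → (X i ≡ -[1+ 0 ]) ⊎ (X i ≡ + 0)

Υ : (n : ℕ) → Point n → Set
Υ n U = Σ (Point n) λ X → InMinusOneZero X × (dist₁ X U ℕ.≤ 1)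

InTranslate : ∀ {n} → Point n → Point n → Set
InTranslate {n} X Z = Υ n (λ i → Z i - X i)

-- T ⊆ ℤ^n (as a predicate) is an integer tiling with Υ_n:
-- the translates X + Υ_n (X ∈ T) partition ℤ^n, i.e. every Z lies in
-- some translate, and any two translates containing Z have the same base point.
IsIntegerTiling : (n : ℕ) → (Point n → Set) → Set
IsIntegerTiling n T =
  (∀ (Z : Point n) → Σ (Point n) λ X → T X × InTranslate X Z)
  × (∀ (Z X Y : Point n) → T X → T Y → InTranslate X Z → InTranslate Y Z → X ≡ Y)

𝟎 : ∀ {n} → Point n
𝟎 _ = + 0

scaledUnit : ∀ {n} → ℤ → Fin n → Point n
scaledUnit k r i with Data.Fin._≟_ r i
... | Relation.Nullary.yes _ = k
... | Relation.Nullary.no _ = + 0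

InZeroOneFour : ℤ → Set
InZeroOneFour z = (z ≡ + 0) ⊎ (z ≡ + 1) ⊎ (z ≡ + 4)

D₂ : (n : ℕ) → Point n → Set
D₂ n X = (∀ i → InZeroOneFour (X i))
       × (Σ (Fin n) λ j → (X j ≡ + 4) × (∀ k → X k ≡ + 4 → k ≡ j))

module Submission where

-- Let X ∈ D₂ ∩ T have its 4 at position j.  Off j the
-- coordinates of X lie in {0,1}; we show none equals 1.  Suppose X k = 1
-- with k ≠ j, and put Q = e_j + e_k.  Q lies in no translate 𝟎 + Υ_n (two
-- coordinates equal to 1) nor X + Υ_n (coordinate j equals 1 - 4).  Let
-- Y + Υ_n, Y ∈ T, be the translate containing Q; then Y j ∈ {0,1,2,3}.
-- Moving the j-th coordinate of Q to 0 (if Y j ≤ 1) or to Y j (if Y j ≥ 2)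
-- gives a point that stays in Y + Υ_n but also lies in 𝟎 + Υ_n resp.
-- X + Υ_n; by uniqueness of the covering tile Y = 𝟎 resp. Y = X, so Q lies
-- in one of the two forbidden translates.

open import Defs
open import Data.Nat using (ℕ)
open import Data.Integer using (+_)
open import Data.Fin using (Fin)
open import Data.Product using (Σ)
open import Relation.Binary.PropositionalEquality using (_≡_)

import Data.Nat as ℕ
import Data.Nat.Properties as NP
open import Data.Integer using (ℤ; -[1+_]; _-_; ∣_∣)
import Data.Integer.Properties as ℤP
open import Data.Fin using (zero; suc; _≟_)
open import Data.Fin.Properties using (suc-injective)
open import Data.Vec.Functional using (updateAt)
open import Data.Vec.Functional.Properties using (updateAt-updates; updateAt-minimal)
open import Data.Product using (_×_; _,_; proj₁; proj₂)
open import Data.Sum using (_⊎_; inj₁; inj₂; [_,_])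
import Data.Sum as Sum
open import Data.Empty using (⊥; ⊥-elim)
open import Function using (_∘_; id; const)
open import Relation.Nullary using (¬_; yes; no)
open import Relation.Binary.PropositionalEquality
  using (refl; sym; trans; cong; cong₂; subst; _≢_)

entry≤sum : ∀ {n} (v : Fin n → ℕ) i → v i ℕ.≤ sumℕ v
entry≤sum v zero    = NP.m≤m+n (v zero) _
entry≤sum v (suc i) = NP.≤-trans (entry≤sum (v ∘ suc) i) (NP.m≤n+m _ (v zero))

pair≤sum : ∀ {n} (v : Fin n → ℕ) i i' → i ≢ i' → v i ℕ.+ v i' ℕ.≤ sumℕ v
pair≤sum v zero    zero     i≢i' = ⊥-elim (i≢i' refl)
pair≤sum v zero    (suc i') _    = NP.+-monoʳ-≤ (v zero) (entry≤sum (v ∘ suc) i')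
pair≤sum v (suc i) zero     _    =
  subst (ℕ._≤ sumℕ v) (NP.+-comm (v zero) (v (suc i)))
        (NP.+-monoʳ-≤ (v zero) (entry≤sum (v ∘ suc) i))
pair≤sum v (suc i) (suc i') i≢i' =
  NP.≤-trans (pair≤sum (v ∘ suc) i i' (i≢i' ∘ cong suc)) (NP.m≤n+m _ (v zero))

sum-zero : ∀ {n} (v : Fin n → ℕ) → (∀ i → v i ≡ 0) → sumℕ v ≡ 0
sum-zero {ℕ.zero}  v _   = refl
sum-zero {ℕ.suc n} v v≡0 rewrite v≡0 zero = sum-zero (v ∘ suc) (v≡0 ∘ suc)

sum≤1 : ∀ {n} (v : Fin n → ℕ) → (∀ i → v i ℕ.≤ 1) →
        (∀ i i' → i ≢ i' → v i ≡ 0 ⊎ v i' ≡ 0) → sumℕ v ℕ.≤ 1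
sum≤1 {ℕ.zero}  v _   _         = ℕ.z≤n
sum≤1 {ℕ.suc n} v v≤1 one-nonzero with v zero ℕ.≟ 0
... | yes v₀≡0 rewrite v₀≡0 =
  sum≤1 (v ∘ suc) (v≤1 ∘ suc)
        (λ i i' i≢i' → one-nonzero (suc i) (suc i') (i≢i' ∘ suc-injective))
... | no v₀≢0 = begin
  v zero ℕ.+ sumℕ (v ∘ suc) ≡⟨ cong (v zero ℕ.+_) (sum-zero (v ∘ suc) tail-zero) ⟩
  v zero ℕ.+ 0              ≡⟨ NP.+-identityʳ (v zero) ⟩
  v zero                    ≤⟨ v≤1 zero ⟩
  1                         ∎
  where
  open NP.≤-Reasoning
  tail-zero : ∀ i → v (suc i) ≡ 0
  tail-zero i = [ ⊥-elim ∘ v₀≢0 , id ] (one-nonzero zero (suc i) (λ ()))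

data Central : ℤ → Set where
  minus-one : Central -[1+ 0 ]
  zero₀     : Central (+ 0)

-- The values at distance ≤ 1 from {-1,0}: the central ones and -2, 1.
data Near : ℤ → Set where
  central   : ∀ {u} → Central u → Near u
  minus-two : Near -[1+ 1 ]
  one       : Near (+ 1)

Shape : ∀ {n} → Point n → Set
Shape {n} U = (∀ i → Near (U i))
            × (∀ (i i' : Fin n) → i ≢ i' → Central (U i) ⊎ Central (U i'))

base-central : ∀ {w} → (w ≡ -[1+ 0 ]) ⊎ (w ≡ + 0) → Central w
base-central (inj₁ refl) = minus-one
base-central (inj₂ refl) = zero₀

near-of-close : ∀ {w} u → Central w → ∣ w - u ∣ ℕ.≤ 1 → Near u
near-of-close (+ 0)                       minus-one _ = central zero₀
near-of-close (+ ℕ.suc _)                 minus-one (ℕ.s≤s ())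
near-of-close -[1+ 0 ]                    minus-one _ = central minus-one
near-of-close -[1+ 1 ]                    minus-one _ = minus-two
near-of-close -[1+ ℕ.suc (ℕ.suc _) ]      minus-one (ℕ.s≤s ())
near-of-close (+ 0)                       zero₀     _ = central zero₀
near-of-close (+ 1)                       zero₀     _ = one
near-of-close (+ ℕ.suc (ℕ.suc _))         zero₀     (ℕ.s≤s ())
near-of-close -[1+ 0 ]                    zero₀     _ = central minus-one
near-of-close -[1+ ℕ.suc _ ]              zero₀     (ℕ.s≤s ())

central-of-equal : ∀ {w} u → Central w → ∣ w - u ∣ ≡ 0 → Central u
central-of-equal u c d = subst Central (ℤP.i-j≡0⇒i≡j _ u (ℤP.∣i∣≡0⇒i≡0 d)) c

-- Every point of Υ_n has the shape: a second non-central coordinate would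
-- add a second unit to the ℓ¹ distance from the base point.
Υ→Shape : ∀ {n} {U : Point n} → Υ n U → Shape U
Υ→Shape {n} {U} (W , W-base , W-close) = near , edges
  where
  d : Fin n → ℕ
  d i = ∣ W i - U i ∣
  near : ∀ i → Near (U i)
  near i = near-of-close (U i) (base-central (W-base i))
                         (NP.≤-trans (entry≤sum d i) W-close)
  edges : ∀ i i' → i ≢ i' → Central (U i) ⊎ Central (U i')
  edges i i' i≢i' with d i ℕ.≟ 0 | d i' ℕ.≟ 0
  ... | yes dᵢ≡0 | _         = inj₁ (central-of-equal (U i) (base-central (W-base i)) dᵢ≡0)
  ... | no _     | yes dᵢ'≡0 = inj₂ (central-of-equal (U i') (base-central (W-base i')) dᵢ'≡0)
  ... | no dᵢ≢0  | no dᵢ'≢0  = ⊥-elim (NP.<-irrefl refl (NP.≤-trans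
        (NP.+-mono-≤ (NP.n≢0⇒n>0 dᵢ≢0) (NP.n≢0⇒n>0 dᵢ'≢0))
        (NP.≤-trans (pair≤sum d i i' i≢i') W-close)))

base-of : ∀ {u} → Near u → ℤ
base-of {u} (central _) = u
base-of minus-two       = -[1+ 0 ]
base-of one             = + 0

base-of-base : ∀ {u} (c : Near u) → (base-of c ≡ -[1+ 0 ]) ⊎ (base-of c ≡ + 0)
base-of-base (central minus-one) = inj₁ refl
base-of-base (central zero₀)     = inj₂ refl
base-of-base minus-two           = inj₁ refl
base-of-base one                 = inj₂ refl

base-of-close : ∀ {u} (c : Near u) → ∣ base-of c - u ∣ ℕ.≤ 1
base-of-close (central minus-one) = ℕ.z≤n
base-of-close (central zero₀)     = ℕ.z≤n
base-of-close minus-two           = ℕ.s≤s ℕ.z≤n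
base-of-close one                 = ℕ.s≤s ℕ.z≤n

base-of-exact : ∀ {u} (c : Near u) → Central u → ∣ base-of c - u ∣ ≡ 0
base-of-exact (central minus-one) _ = refl
base-of-exact (central zero₀)     _ = refl
base-of-exact minus-two           ()
base-of-exact one                 ()

Shape→Υ : ∀ {n} {U : Point n} → Shape U → Υ n U
Shape→Υ (near , edges) =
  (λ i → base-of (near i)) , (λ i → base-of-base (near i)) ,
  sum≤1 _ (λ i → base-of-close (near i))
        (λ i i' i≢i' → Sum.map (base-of-exact (near i)) (base-of-exact (near i'))
                               (edges i i' i≢i'))

shape-cong : ∀ {n} {U V : Point n} → (∀ i → U i ≡ V i) → Shape U → Shape V
shape-cong U≡V (near , edges) =
  (λ i → subst Near (U≡V i) (near i)) ,
  (λ i i' i≢i' → Sum.map (subst Central (U≡V i)) (subst Central (U≡V i'))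
                         (edges i i' i≢i'))

shape-reset : ∀ {n} {U V : Point n} j → Shape U →
              (∀ i → i ≢ j → V i ≡ U i) → Central (V j) → Shape V
shape-reset {U = U} {V} j (nearU , edgesU) agree cⱼ = near , edges
  where
  near : ∀ i → Near (V i)
  near i with i ≟ j
  ... | yes refl = central cⱼ
  ... | no i≢j   = subst Near (sym (agree i i≢j)) (nearU i)
  edges : ∀ i i' → i ≢ i' → Central (V i) ⊎ Central (V i')
  edges i i' i≢i' with i ≟ j | i' ≟ j
  ... | yes refl | _         = inj₁ cⱼ
  ... | no _     | yes refl  = inj₂ cⱼ
  ... | no i≢j   | no i'≢j   =
    Sum.map (subst Central (sym (agree i i≢j))) (subst Central (sym (agree i' i'≢j)))
            (edgesU i i' i≢i')

shape-single : ∀ {n} {V : Point n} m → Near (V m) →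
               (∀ i → i ≢ m → Central (V i)) → Shape V
shape-single {V = V} m nearₘ others = near , edges
  where
  near : ∀ i → Near (V i)
  near i with i ≟ m
  ... | yes refl = nearₘ
  ... | no i≢m   = central (others i i≢m)
  edges : ∀ i i' → i ≢ i' → Central (V i) ⊎ Central (V i')
  edges i i' i≢i' with i ≟ m
  ... | yes refl = inj₂ (others i' (i≢i' ∘ sym))
  ... | no i≢m   = inj₁ (others i i≢m)

scaledUnit-on : ∀ {n} c (r : Fin n) → scaledUnit c r r ≡ c
scaledUnit-on c r with r ≟ r
... | yes _   = refl
... | no r≢r  = ⊥-elim (r≢r refl)

scaledUnit-off : ∀ {n} c {r i : Fin n} → r ≢ i → scaledUnit c r i ≡ + 0
scaledUnit-off c {r} {i} r≢i with r ≟ i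
... | yes r≡i = ⊥-elim (r≢i r≡i)
... | no _    = refl

unit-shape : ∀ {n} (k : Fin n) → Shape (scaledUnit (+ 1) k)
unit-shape k =
  shape-single k (subst Near (sym (scaledUnit-on (+ 1) k)) one)
               (λ i i≢k → subst Central (sym (scaledUnit-off (+ 1) (i≢k ∘ sym))) zero₀)

InTile : ∀ {n} → Point n → Point n → Set
InTile Y Z = Shape (λ i → Z i - Y i)

tile-unique : ∀ {n} {T : Point n → Set} → IsIntegerTiling n T →
              ∀ Z {Y W} → T Y → T W → InTile Y Z → InTile W Z → Y ≡ W
tile-unique tiling Z {Y} {W} TY TW Z∈Y Z∈W =
  proj₂ tiling Z Y W TY TW (Shape→Υ Z∈Y) (Shape→Υ Z∈W)

-- If 1 - y is near then y ∈ {0,1,2,3}: either 0 - y is central (y ≤ 1)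
-- or y - 4 is near (y ≥ 2).
split-height : ∀ y → Near (+ 1 - y) → Central (+ 0 - y) ⊎ Near (y - + 4)
split-height (+ 0) _ = inj₁ zero₀
split-height (+ 1) _ = inj₁ minus-one
split-height (+ 2) _ = inj₂ minus-two
split-height (+ 3) _ = inj₂ (central minus-one)
split-height (+ ℕ.suc (ℕ.suc (ℕ.suc (ℕ.suc _)))) (central ())
split-height -[1+ _ ] (central ())

off-peak : ∀ {n} {X : Point n} {j} → (∀ i → InZeroOneFour (X i)) →
           (∀ k → X k ≡ + 4 → k ≡ j) → ∀ i → i ≢ j → X i ≡ + 0 ⊎ X i ≡ + 1
off-peak X∈014 peak-unique i i≢j with X∈014 i
... | inj₁ Xᵢ≡0        = inj₁ Xᵢ≡0
... | inj₂ (inj₁ Xᵢ≡1) = inj₂ Xᵢ≡1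
... | inj₂ (inj₂ Xᵢ≡4) = ⊥-elim (i≢j (peak-unique i Xᵢ≡4))

module NoOneBesidePeak
  {n} {T : Point n → Set} (tiling : IsIntegerTiling n T) (T𝟎 : T 𝟎)
  {X : Point n} (TX : T X) {j k : Fin n} (j≢k : j ≢ k)
  (Xⱼ≡4 : X j ≡ + 4) (Xₖ≡1 : X k ≡ + 1)
  (X-off : ∀ i → i ≢ j → X i ≡ + 0 ⊎ X i ≡ + 1) where

  -- e_k with its j-th coordinate set to c; Q = e_j + e_k.
  Z : ℤ → Point n
  Z c = updateAt (scaledUnit (+ 1) k) j (const c)

  Q : Point n
  Q = Z (+ 1)

  Z-at-j : ∀ c → Z c j ≡ c
  Z-at-j c = updateAt-updates j (scaledUnit (+ 1) k)

  Z-off-j : ∀ c {i} → i ≢ j → Z c i ≡ scaledUnit (+ 1) k i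
  Z-off-j c {i} i≢j = updateAt-minimal i j (scaledUnit (+ 1) k) i≢j

  Q-at-k : Q k ≡ + 1
  Q-at-k = trans (Z-off-j (+ 1) (j≢k ∘ sym)) (scaledUnit-on (+ 1) k)

  -- Q has two coordinates equal to 1.
  Q∉𝟎 : ¬ InTile 𝟎 Q
  Q∉𝟎 (_ , edges) =
    [ not-central-one ∘ subst Central (cong (_- + 0) (Z-at-j (+ 1)))
    , not-central-one ∘ subst Central (cong (_- + 0) Q-at-k)
    ] (edges j k j≢k)
    where not-central-one : ¬ Central (+ 1)
          not-central-one ()

  -- The j-th coordinate of Q - X is 1 - 4.
  Q∉X : ¬ InTile X Q
  Q∉X (near , _) = not-near (subst Near (cong₂ _-_ (Z-at-j (+ 1)) Xⱼ≡4) (near j))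
    where not-near : ¬ Near (+ 1 - + 4)
          not-near (central ())

  Y : Point n
  Y = proj₁ (proj₁ tiling Q)

  TY : T Y
  TY = proj₁ (proj₂ (proj₁ tiling Q))

  Q∈Y : InTile Y Q
  Q∈Y = Υ→Shape (proj₂ (proj₂ (proj₁ tiling Q)))

  relocate : ∀ c {W} → T W → Central (c - Y j) → InTile W (Z c) → InTile W Q
  relocate c {W} TW c-central Zc∈W =
    subst (λ V → InTile V Q) (tile-unique tiling (Z c) TY TW Zc∈Y Zc∈W) Q∈Y
    where
    Zc∈Y : InTile Y (Z c)
    Zc∈Y = shape-reset j Q∈Y
      (λ i i≢j → cong (_- Y i) (trans (Z-off-j c i≢j) (sym (Z-off-j (+ 1) i≢j))))
      (subst Central (cong (_- Y j) (sym (Z-at-j c))) c-central)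

  -- Y j ∈ {0,1}: then Z 0 = e_k lies in 𝟎 + Υ_n.
  low-case : Central (+ 0 - Y j) → ⊥
  low-case c = Q∉𝟎 (relocate (+ 0) T𝟎 c (shape-cong Z₀≡e_k (unit-shape k)))
    where
    Z₀≡e_k : ∀ i → scaledUnit (+ 1) k i ≡ Z (+ 0) i - + 0
    Z₀≡e_k i with i ≟ j
    ... | yes refl = trans (scaledUnit-off (+ 1) (j≢k ∘ sym))
                           (sym (trans (ℤP.+-identityʳ (Z (+ 0) i)) (Z-at-j (+ 0))))
    ... | no i≢j   = sym (trans (ℤP.+-identityʳ (Z (+ 0) i)) (Z-off-j (+ 0) i≢j))

  -- Y j ∈ {2,3}: then Z (Y j) lies in X + Υ_n.
  high-case : Near (Y j - + 4) → ⊥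
  high-case near = Q∉X (relocate (Y j) TX Yⱼ-Yⱼ-central
                          (shape-single j (subst Near (sym (cong₂ _-_ (Z-at-j (Y j)) Xⱼ≡4)) near)
                                        others))
    where
    Yⱼ-Yⱼ-central : Central (Y j - Y j)
    Yⱼ-Yⱼ-central = subst Central (sym (ℤP.+-inverseʳ (Y j))) zero₀
    others : ∀ i → i ≢ j → Central (Z (Y j) i - X i)
    others i i≢j rewrite Z-off-j (Y j) i≢j with k ≟ i
    ... | yes refl = subst Central (sym (cong (+ 1 -_) Xₖ≡1)) zero₀
    ... | no k≢i with X-off i i≢j
    ...   | inj₁ Xᵢ≡0 = subst Central (sym (cong (+ 0 -_) Xᵢ≡0)) zero₀
    ...   | inj₂ Xᵢ≡1 = subst Central (sym (cong (+ 0 -_) Xᵢ≡1)) minus-one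

  contradiction : ⊥
  contradiction =
    [ low-case , high-case ]
      (split-height (Y j) (subst (λ q → Near (q - Y j)) (Z-at-j (+ 1)) (proj₁ Q∈Y j)))

lemma11 : (n : ℕ) (T : Point n → Set) → IsIntegerTiling n T → T 𝟎 →
    (X : Point n) → D₂ n X → T X →
    Σ (Fin n) λ r → ∀ i → X i ≡ scaledUnit (+ 4) r i
lemma11 n T tiling T𝟎 X (X∈014 , j , Xⱼ≡4 , peak-unique) TX = j , X≡4eⱼ
  where
  X-off : ∀ i → i ≢ j → X i ≡ + 0 ⊎ X i ≡ + 1
  X-off = off-peak X∈014 peak-unique
  X≡4eⱼ : ∀ i → X i ≡ scaledUnit (+ 4) j i
  X≡4eⱼ i with j ≟ i
  ... | yes refl = Xⱼ≡4
  ... | no j≢i with X-off i (j≢i ∘ sym)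
  ...   | inj₁ Xᵢ≡0 = Xᵢ≡0
  ...   | inj₂ Xᵢ≡1 =
    ⊥-elim (NoOneBesidePeak.contradiction tiling T𝟎 TX j≢i Xⱼ≡4 Xᵢ≡1 X-off)
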